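{- Let $k>\ell\ge 1$ be integers. Let $A_1,A_2,\ldots,A_k$ be finite sets such that $\bigl|\bigcup_{i=1}^k A_i\bigr|=n$. Let \[q=\left\lfloor \frac{2}{k+\ell-1}\left(n+\frac{k-\ell}{2}\right)\right\rfloor.\] Then there exists a partition $(B_0,B_1,\ldots,B_\ell)$ of $\bigcup_{i=1}^k A_i$ into $\ell+1$ sets, possibly empty, such that (i) for each $1\le i\le \ell$, $B_i$ is a subset of the union of two members of $\{A_1,A_2,\ldots,A_k\}$; (ii) $|B_i|\ge q+1$ if $1\le i\le \lceil n-\frac{k+\ell-1}{2}q\rceil$; (iii) $|B_i|\ge q$ if $\lceil n-\frac{k+\ell-1}{2}q\rceil< i\le \ell$; (iv) there exists $I\subseteq\{1,2,\ldots,k\}$ with $|I|=k-\ell-1$ such that $B_0\subseteq\bigcup_{i\in I}A_i$. -}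

module Defs where

open import Data.Nat using (ℕ; suc; _+_; _*_; _∸_; _/_)
open import Data.Fin using (Fin; _≟_)
open import Data.Fin.Subset using (Subset)
open import Data.Vec using (tabulate)
open import Relation.Nullary.Decidable using (⌊_⌋)

Block : ∀ {n m} → (Fin n → Fin m) → Fin m → Subset n
Block part j = tabulate (λ x → ⌊ part x ≟ j ⌋)

-- q = ⌊ 2/(k+ℓ-1) · (n + (k-ℓ)/2) ⌋ = ⌊ (2n + k - ℓ) / (k+ℓ-1) ⌋   (for k > ℓ ≥ 1)
qVal : ℕ → ℕ → ℕ → ℕ
qVal k ℓ n = (2 * n + (k ∸ ℓ)) / suc ((k + ℓ) ∸ 2)

-- r = ⌈ n - (k+ℓ-1) q / 2 ⌉ truncated at 0
--   = ⌈ (2n - (k+ℓ-1) q) / 2 ⌉  when nonnegative, else 0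
-- (truncation is harmless: indices i ≥ 1 never satisfy i ≤ r when r ≤ 0)
rVal : ℕ → ℕ → ℕ → ℕ
rVal k ℓ n = suc (2 * n ∸ ((k + ℓ) ∸ 1) * qVal k ℓ n) / 2

module Submission where

-- Colour every element x by some i with x ∈ A i and induct on ℓ. Let T = q + [r ≥ 1] be the
-- demand on the first block. Take a largest colour class a and a largest class b among the
-- others; averaging over the k classes (n = Σ c, k T < 2n + k) gives c_b ≤ T ≤ c_a + c_b, and if
-- instead c_b > T some other class has size ≤ T because n < k (T + 1). Block 1 is then class b
-- topped up with T − c_b elements of class a. Deleting block 1 and colour b leaves an instance
-- with k − 1 colours, ℓ − 1 blocks and n − T elements, whose quotas dominate the remaining
-- quotas of the original instance; block 0 inherits the colour set of the smaller instance.
-- For ℓ = 1 block 1 is all of classes a and b, and block 0 uses the remaining k − 2 colours.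

open import Defs
open import Data.Nat using (ℕ; suc; _+_; _∸_; _≤_; _<_)
open import Data.Fin using (Fin; zero; suc; toℕ)
open import Relation.Binary.PropositionalEquality using (_≡_)
open import Data.Fin.Subset using (Subset; _∈_; _⊆_; _∪_; ∣_∣)
open import Data.Product using (Σ; _×_; ∃; ∃-syntax)

open import Data.Bool using (Bool; true; false; _∨_; if_then_else_)
open import Data.Bool.Properties using (∨-zeroʳ)
open import Data.Empty using (⊥-elim)
open import Data.Fin using (_≟_; punchIn; punchOut)
open import Data.Fin.Properties using (punchInᵢ≢i; punchIn-punchOut; punchIn-injective; any?)
open import Data.Fin.Subset using (outside; ⊤)
open import Data.Fin.Subset.Properties using (∈⊤; ∣⊤∣≡n; x∈p∪q⁺)
open import Data.Maybe using (Maybe; just; nothing; is-just; _>>=_)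
open import Data.Maybe.Properties using (just-injective)
open import Data.Nat using (zero; _*_; z≤n; s≤s; _≤?_; _<?_; NonZero; _/_; _%_)
open import Data.Nat.DivMod using (m≡m%n+[m/n]*n; m%n<n; m/n*n≤m; m*n/n≡m; /-monoˡ-≤)
open import Data.Nat.Properties hiding (_≟_)
open import Data.Nat.Tactic.RingSolver using (solve-∀)
open import Algebra.Properties.CommutativeMonoid.Sum +-0-commutativeMonoid
  using (sum; sum-remove; ∑-distrib-+; ∑-comm; sum-cong-≗; sum-replicate-zero)
open import Data.Product using (∃₂; _,_; proj₁; proj₂)
open import Data.Sum using (_⊎_; inj₁; inj₂)
import Data.Sum as Sum
open import Data.Vec using (tabulate; insertAt)
import Data.Vec as Vec
open import Data.Vec.Functional using (_∷_; removeAt)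
open import Data.Vec.Properties using (insertAt-punchIn; []=⇒lookup; lookup⇒[]=; lookup∘tabulate; tabulate-cong)
open import Function using (_∘_; case_of_)
open import Function.Bundles using (mk⇔)
open import Relation.Binary.PropositionalEquality
  using (_≢_; refl; sym; trans; cong; cong₂; subst; subst₂; module ≡-Reasoning)
open import Relation.Nullary using (Dec; yes; no; does; ¬_)
open import Relation.Nullary.Decidable using (⌊_⌋; dec-true; dec-false; does-⇔; isYes≗does)

-- Counting

indicator : Bool → ℕ
indicator true  = 1
indicator false = 0

count : ∀ {N} → (Fin N → Bool) → ℕ
count P = sum (indicator ∘ P)

count-cong : ∀ {N} {P Q : Fin N → Bool} → (∀ x → P x ≡ Q x) → count P ≡ count Q
count-cong P≗Q = sum-cong-≗ (cong indicator ∘ P≗Q)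

count-+ : ∀ {N} {P Q R : Fin N → Bool} →
          (∀ x → indicator (P x) ≡ indicator (Q x) + indicator (R x)) → count P ≡ count Q + count R
count-+ {Q = Q} {R} split = trans (sum-cong-≗ split) (∑-distrib-+ (indicator ∘ Q) (indicator ∘ R))

count-true : ∀ {N} → count {N} (λ _ → true) ≡ N
count-true {zero}  = refl
count-true {suc N} = cong suc (count-true {N})

∣tabulate∣≡count : ∀ {N} (P : Fin N → Bool) → ∣ tabulate P ∣ ≡ count P
∣tabulate∣≡count {zero}  P = refl
∣tabulate∣≡count {suc N} P with P zero
... | true  = cong suc (∣tabulate∣≡count (P ∘ suc))
... | false = ∣tabulate∣≡count (P ∘ suc)

∃-subpredicate-of-count : ∀ {N} (P : Fin N → Bool) t → t ≤ count P →
                          ∃ λ Q → (∀ x → Q x ≡ true → P x ≡ true) × count Q ≡ t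
∃-subpredicate-of-count {N} P zero _ = (λ _ → false) , (λ _ ()) , sum-replicate-zero N
∃-subpredicate-of-count {suc N} P (suc t) t<P with P zero in P₀
... | true  = let Q , Q⇒P , ∣Q∣ = ∃-subpredicate-of-count (P ∘ suc) t (≤-pred t<P)
              in true ∷ Q , (λ { zero _ → P₀ ; (suc x) → Q⇒P x }) , cong suc ∣Q∣
... | false = let Q , Q⇒P , ∣Q∣ = ∃-subpredicate-of-count (P ∘ suc) (suc t) t<P
              in false ∷ Q , (λ { zero () ; (suc x) → Q⇒P x }) , ∣Q∣

indicator-∨ : ∀ x y → (x ≡ true → y ≡ false) → indicator (x ∨ y) ≡ indicator x + indicator y
indicator-∨ true  y x⇒¬y = cong (λ y → 1 + indicator y) (sym (x⇒¬y refl))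
indicator-∨ false y _    = refl

∨-true : ∀ x y → x ∨ y ≡ true → x ≡ true ⊎ y ≡ true
∨-true true  y _ = inj₁ refl
∨-true false y e = inj₂ e

does⇒ : ∀ {P : Set} (P? : Dec P) → does P? ≡ true → P
does⇒ (yes p) _  = p
does⇒ (no _)  ()

-- Colour classes

-- x ↦ a colour i with x ∈ A i; nothing marks an element already placed in an earlier block.
Colouring : ℕ → ℕ → Set
Colouring N k = Fin N → Maybe (Fin k)

_hasColour_ : ∀ {k} → Maybe (Fin k) → Fin k → Bool
nothing hasColour i = false
just j  hasColour i = does (j ≟ i)

classSize : ∀ {N k} → Colouring N k → Fin k → ℕ
classSize g i = count (λ x → g x hasColour i)

coloured : ∀ {N k} → Colouring N k → ℕ
coloured g = count (is-just ∘ g)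

hasColour⇒≡ : ∀ {k} (m : Maybe (Fin k)) i → m hasColour i ≡ true → m ≡ just i
hasColour⇒≡ nothing  i ()
hasColour⇒≡ (just j) i h = cong just (does⇒ (j ≟ i) h)

≡⇒hasColour : ∀ {k} {m : Maybe (Fin k)} {i} → m ≡ just i → m hasColour i ≡ true
≡⇒hasColour {i = i} refl = dec-true (i ≟ i) refl

hasColour-disjoint : ∀ {k} (m : Maybe (Fin k)) {i j} → i ≢ j → m hasColour i ≡ true → m hasColour j ≡ false
hasColour-disjoint m {i} {j} i≢j has-i =
  trans (cong (_hasColour j) (hasColour⇒≡ m i has-i)) (dec-false (i ≟ j) i≢j)

∑-hasColour : ∀ {k} (m : Maybe (Fin k)) → sum (λ i → indicator (m hasColour i)) ≡ indicator (is-just m)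
∑-hasColour {k}     nothing  = sum-replicate-zero k
∑-hasColour {suc k} (just j) = begin
  sum f                     ≡⟨ sum-remove {i = j} f ⟩
  f j + sum (removeAt f j)  ≡⟨ cong₂ _+_ (cong indicator (dec-true (j ≟ j) refl)) others ⟩
  1                         ∎
  where
  open ≡-Reasoning
  f : Fin (suc k) → ℕ
  f i = indicator (just j hasColour i)
  others-zero : ∀ i → removeAt f j i ≡ 0
  others-zero i = cong indicator (dec-false (j ≟ punchIn j i) (punchInᵢ≢i j i ∘ sym))
  others : sum (removeAt f j) ≡ 0
  others = trans (sum-cong-≗ others-zero) (sum-replicate-zero k)

∑-classSize : ∀ {N k} (g : Colouring N k) → sum (classSize g) ≡ coloured g
∑-classSize g = trans (∑-comm (λ i x → indicator (g x hasColour i))) (sum-cong-≗ (∑-hasColour ∘ g))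

sum-≤ : ∀ {n} (f : Fin n → ℕ) {m} → (∀ i → f i ≤ m) → sum f ≤ n * m
sum-≤ {zero}  f _   = z≤n
sum-≤ {suc n} f f≤m = +-mono-≤ (f≤m zero) (sum-≤ (f ∘ suc) (f≤m ∘ suc))

sum-≥ : ∀ {n} (f : Fin n → ℕ) {m} → (∀ i → m ≤ f i) → n * m ≤ sum f
sum-≥ {zero}  f _   = z≤n
sum-≥ {suc n} f m≤f = +-mono-≤ (m≤f zero) (sum-≥ (f ∘ suc) (m≤f ∘ suc))

argmax : ∀ {n} (f : Fin (suc n) → ℕ) → ∃ λ a → ∀ i → f i ≤ f a
argmax {zero}  f = zero , λ { zero → ≤-refl }
argmax {suc n} f with argmax (f ∘ suc)
... | a , f≤fa with f zero ≤? f (suc a)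
...   | yes f₀≤fa = suc a , λ { zero → f₀≤fa ; (suc i) → f≤fa i }
...   | no  f₀≰fa = zero , λ { zero → ≤-refl ; (suc i) → ≤-trans (f≤fa i) (≰⇒≥ f₀≰fa) }

two-largest-average : ∀ K x y s → s ≤ x + suc K * y → y ≤ x → 2 * s ≤ (2 + K) * (x + y)
two-largest-average K x y s s≤ y≤x = begin
  2 * s                            ≤⟨ *-monoʳ-≤ 2 s≤ ⟩
  2 * (x + suc K * y)              ≡⟨ expand K x y ⟩
  (2 * x + 2 * y + K * y) + K * y  ≤⟨ +-monoʳ-≤ (2 * x + 2 * y + K * y) (*-monoʳ-≤ K y≤x) ⟩
  (2 * x + 2 * y + K * y) + K * x  ≡⟨ collect K x y ⟩
  (2 + K) * (x + y)                ∎
  where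
  open ≤-Reasoning
  expand : ∀ K x y → 2 * (x + suc K * y) ≡ (2 * x + 2 * y + K * y) + K * y
  expand = solve-∀
  collect : ∀ K x y → (2 * x + 2 * y + K * y) + K * x ≡ (2 + K) * (x + y)
  collect = solve-∀

straddling-pair : ∀ {K} (c : Fin (2 + K) → ℕ) T →
                  (2 + K) * T < 2 * sum c + (2 + K) → sum c < (2 + K) * suc T →
                  ∃₂ λ a b → a ≢ b × c b ≤ T × T ≤ c a + c b
straddling-pair {K} c T upper lower with argmax c
... | a , c≤ca with argmax (removeAt c a)
... | b , c≤cb with c (punchIn a b) ≤? T
... | yes cb≤T = a , punchIn a b , punchInᵢ≢i a b ∘ sym , cb≤T , T≤ca+cb
  where
  open ≤-Reasoning
  s≤ : sum c ≤ c a + suc K * c (punchIn a b)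
  s≤ = begin
    sum c                          ≡⟨ sum-remove {i = a} c ⟩
    c a + sum (removeAt c a)       ≤⟨ +-monoʳ-≤ (c a) (sum-≤ (removeAt c a) c≤cb) ⟩
    c a + suc K * c (punchIn a b)  ∎
  T≤ca+cb : T ≤ c a + c (punchIn a b)
  T≤ca+cb = ≤-pred (*-cancelˡ-< (2 + K) T _ (begin-strict
    (2 + K) * T                                  <⟨ upper ⟩
    2 * sum c + (2 + K)                          ≤⟨ +-monoˡ-≤ (2 + K) (two-largest-average K _ _ _ s≤ (c≤ca _)) ⟩
    (2 + K) * (c a + c (punchIn a b)) + (2 + K)  ≡⟨ +-comm _ (2 + K) ⟩
    (2 + K) + (2 + K) * (c a + c (punchIn a b))  ≡⟨ *-suc (2 + K) _ ⟨
    (2 + K) * suc (c a + c (punchIn a b))        ∎))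
... | no cb≰T with any? (λ i → c (punchIn a i) ≤? T)
...   | yes (b′ , cb′≤T) = a , punchIn a b′ , punchInᵢ≢i a b′ ∘ sym , cb′≤T ,
                           ≤-trans (≤-trans (<⇒≤ (≰⇒> cb≰T)) (c≤ca _)) (m≤m+n (c a) _)
...   | no none≤T = ⊥-elim (<⇒≱ lower (begin
    (2 + K) * suc T           ≤⟨ +-mono-≤ (≤-trans (≰⇒> cb≰T) (c≤ca _))
                                          (sum-≥ (removeAt c a) (λ i → ≰⇒> (none≤T ∘ (i ,_)))) ⟩
    c a + sum (removeAt c a)  ≡⟨ sum-remove {i = a} c ⟨
    sum c                     ∎))
  where open ≤-Reasoning

-- Quotas

n*[m/n]≤m : ∀ m n .{{_ : NonZero n}} → n * (m / n) ≤ m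
n*[m/n]≤m m n = subst (_≤ m) (*-comm (m / n) n) (m/n*n≤m m n)

m<n*[1+m/n] : ∀ m n .{{_ : NonZero n}} → m < n * suc (m / n)
m<n*[1+m/n] m n = begin-strict
  m                  ≡⟨ m≡m%n+[m/n]*n m n ⟩
  m % n + m / n * n  <⟨ +-monoˡ-< (m / n * n) (m%n<n m n) ⟩
  n + m / n * n      ≡⟨ cong (n +_) (*-comm (m / n) n) ⟩
  n + n * (m / n)    ≡⟨ *-suc n (m / n) ⟨
  n * suc (m / n)    ∎
  where open ≤-Reasoning

n*o≤m⇒o≤m/n : ∀ m n o .{{_ : NonZero n}} → n * o ≤ m → o ≤ m / n
n*o≤m⇒o≤m/n m n o no≤m =
  subst (_≤ m / n) (m*n/n≡m o n) (/-monoˡ-≤ n (subst (_≤ m) (*-comm n o) no≤m))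

i<[1+m∸p]/2⇒p+2i<m : ∀ m p i → i < suc (m ∸ p) / 2 → p + 2 * i < m
i<[1+m∸p]/2⇒p+2i<m m p i i< = begin-strict
  p + 2 * i  ≡⟨ +-comm p (2 * i) ⟩
  2 * i + p  <⟨ m≤o∸n⇒m+n≤o (suc (2 * i)) p≤m 2i<m∸p ⟩
  m          ∎
  where
  open ≤-Reasoning
  2i<m∸p : 2 * i < m ∸ p
  2i<m∸p = ≤-pred (≤-trans (≤-reflexive (cong (2 +_) (*-comm 2 i)))
                           (≤-trans (*-monoˡ-≤ 2 i<) (m/n*n≤m (suc (m ∸ p)) 2)))
  p≤m : p ≤ m
  p≤m = <⇒≤ (m∸n≢0⇒n<m λ m∸p≡0 → n≮0 (subst (2 * i <_) m∸p≡0 2i<m∸p))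

-- Block i + 1 must get q + 1 elements when i < r and q otherwise. Surplus is the condition
-- i < r = ⌈(2n − (k+ℓ−1) q) / 2⌉ without the division, the form in which quotas of successive
-- instances are compared.
Surplus : ℕ → ℕ → ℕ → ℕ → Set
Surplus k ℓ n i = (k + ℓ ∸ 1) * qVal k ℓ n + 2 * i < 2 * n

surplus? : ∀ k ℓ n i → Dec (Surplus k ℓ n i)
surplus? k ℓ n i = (k + ℓ ∸ 1) * qVal k ℓ n + 2 * i <? 2 * n

demand : ℕ → ℕ → ℕ → ℕ → ℕ
demand k ℓ n i = if does (surplus? k ℓ n i) then suc (qVal k ℓ n) else qVal k ℓ n

demand-surplus : ∀ k ℓ n i → Surplus k ℓ n i → demand k ℓ n i ≡ suc (qVal k ℓ n)
demand-surplus k ℓ n i s =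
  cong (λ b → if b then suc (qVal k ℓ n) else qVal k ℓ n) (dec-true (surplus? k ℓ n i) s)

demand-no-surplus : ∀ k ℓ n i → ¬ Surplus k ℓ n i → demand k ℓ n i ≡ qVal k ℓ n
demand-no-surplus k ℓ n i ¬s =
  cong (λ b → if b then suc (qVal k ℓ n) else qVal k ℓ n) (dec-false (surplus? k ℓ n i) ¬s)

q≤demand : ∀ k ℓ n i → qVal k ℓ n ≤ demand k ℓ n i
q≤demand k ℓ n i with surplus? k ℓ n i
... | yes s  = ≤-trans (n≤1+n _) (≤-reflexive (sym (demand-surplus k ℓ n i s)))
... | no  ¬s = ≤-reflexive (sym (demand-no-surplus k ℓ n i ¬s))

demand≤1+q : ∀ k ℓ n i → demand k ℓ n i ≤ suc (qVal k ℓ n)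
demand≤1+q k ℓ n i with surplus? k ℓ n i
... | yes s  = ≤-reflexive (demand-surplus k ℓ n i s)
... | no  ¬s = ≤-trans (≤-reflexive (demand-no-surplus k ℓ n i ¬s)) (n≤1+n _)

<rVal⇒1+q≤demand : ∀ k ℓ n i → i < rVal k ℓ n → suc (qVal k ℓ n) ≤ demand k ℓ n i
<rVal⇒1+q≤demand k ℓ n i i<r = ≤-reflexive (sym (demand-surplus k ℓ n i
  (i<[1+m∸p]/2⇒p+2i<m (2 * n) ((k + ℓ ∸ 1) * qVal k ℓ n) i i<r)))

[2+D]q+j<2[n+T]⇒Dq+j≤1+2n : ∀ D q n T j → (2 + D) * q + j < 2 * (n + T) → T ≤ suc q →
                             D * q + j ≤ suc (2 * n)
[2+D]q+j<2[n+T]⇒Dq+j≤1+2n D q n T j lt T≤ = ≤-pred (+-cancelˡ-< (2 * q) (D * q + j) (2 + 2 * n) (begin-strict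
  2 * q + (D * q + j)  ≡⟨ regroup D q j ⟩
  (2 + D) * q + j      <⟨ lt ⟩
  2 * (n + T)          ≤⟨ *-monoʳ-≤ 2 (+-monoʳ-≤ n T≤) ⟩
  2 * (n + suc q)      ≡⟨ expand n q ⟩
  2 * q + (2 + 2 * n)  ∎))
  where
  open ≤-Reasoning
  regroup : ∀ D q j → 2 * q + (D * q + j) ≡ (2 + D) * q + j
  regroup = solve-∀
  expand : ∀ n q → 2 * (n + suc q) ≡ 2 * q + (2 + 2 * n)
  expand = solve-∀

[2+D]q≤2[n+q]+d⇒Dq≤2n+d : ∀ D q n d → (2 + D) * q ≤ 2 * (n + q) + d → D * q ≤ 2 * n + d
[2+D]q≤2[n+q]+d⇒Dq≤2n+d D q n d le =
  +-cancelˡ-≤ (2 * q) (D * q) (2 * n + d) (subst₂ _≤_ (split D q) (regroup n q d) le)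
  where
  split : ∀ D q → (2 + D) * q ≡ 2 * q + D * q
  split = solve-∀
  regroup : ∀ n q d → 2 * (n + q) + d ≡ 2 * q + (2 * n + d)
  regroup = solve-∀

module Quota {k ℓ : ℕ} (1≤ℓ : 1 ≤ ℓ) (ℓ<k : ℓ < k) where

  D d : ℕ
  D = k + ℓ ∸ 1
  d = k ∸ ℓ

  private
    1≤k : 1 ≤ k
    1≤k = ≤-trans (s≤s z≤n) ℓ<k

  divisor≡D : suc (k + ℓ ∸ 2) ≡ D
  divisor≡D = suc[m∸2]≡m∸1 (+-mono-≤ 1≤k 1≤ℓ)
    where
    suc[m∸2]≡m∸1 : ∀ {m} → 2 ≤ m → suc (m ∸ 2) ≡ m ∸ 1
    suc[m∸2]≡m∸1 (s≤s (s≤s _)) = refl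

  k≤D : k ≤ D
  k≤D = ≤-trans (≤-reflexive (sym (m+n∸n≡m k 1))) (∸-monoˡ-≤ 1 (+-monoʳ-≤ k 1≤ℓ))

  D≤2k : D ≤ 2 * k
  D≤2k = begin
    k + ℓ ∸ 1  ≤⟨ m∸n≤m (k + ℓ) 1 ⟩
    k + ℓ      ≤⟨ +-monoʳ-≤ k (<⇒≤ ℓ<k) ⟩
    k + k      ≡⟨ cong (k +_) (+-identityʳ k) ⟨
    2 * k      ∎
    where open ≤-Reasoning

  0<d : 0 < d
  0<d = m<n⇒0<n∸m ℓ<k

  d<k : d < k
  d<k = ∸-monoʳ-< 1≤ℓ (<⇒≤ ℓ<k)

  q-lower : ∀ n → D * qVal k ℓ n ≤ 2 * n + d
  q-lower n = subst (λ E → E * qVal k ℓ n ≤ 2 * n + d) divisor≡D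
                    (n*[m/n]≤m (2 * n + d) (suc (k + ℓ ∸ 2)))

  q-upper : ∀ n → 2 * n + d < D * suc (qVal k ℓ n)
  q-upper n = subst (λ E → 2 * n + d < E * suc (qVal k ℓ n)) divisor≡D
                    (m<n*[1+m/n] (2 * n + d) (suc (k + ℓ ∸ 2)))

  q-greatest : ∀ n x → D * x ≤ 2 * n + d → x ≤ qVal k ℓ n
  q-greatest n x Dx≤ = n*o≤m⇒o≤m/n (2 * n + d) (suc (k + ℓ ∸ 2)) x
                         (subst (λ E → E * x ≤ 2 * n + d) (sym divisor≡D) Dx≤)

  k*demand₀<2n+k : ∀ n → k * demand k ℓ n 0 < 2 * n + k
  k*demand₀<2n+k n with surplus? k ℓ n 0
  ... | yes s = begin-strict
    k * demand k ℓ n 0  ≡⟨ cong (k *_) (demand-surplus k ℓ n 0 s) ⟩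
    k * suc q           ≡⟨ *-suc k q ⟩
    k + k * q           ≤⟨ +-monoʳ-≤ k (*-monoˡ-≤ q k≤D) ⟩
    k + D * q           <⟨ +-monoʳ-< k (subst (_< 2 * n) (+-identityʳ (D * q)) s) ⟩
    k + 2 * n           ≡⟨ +-comm k (2 * n) ⟩
    2 * n + k           ∎
    where
    open ≤-Reasoning
    q = qVal k ℓ n
  ... | no ¬s = begin-strict
    k * demand k ℓ n 0  ≡⟨ cong (k *_) (demand-no-surplus k ℓ n 0 ¬s) ⟩
    k * q               ≤⟨ *-monoˡ-≤ q k≤D ⟩
    D * q               ≤⟨ q-lower n ⟩
    2 * n + d           <⟨ +-monoʳ-< (2 * n) d<k ⟩
    2 * n + k           ∎
    where
    open ≤-Reasoning
    q = qVal k ℓ n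

  n<k*[1+demand₀] : ∀ n → n < k * suc (demand k ℓ n 0)
  n<k*[1+demand₀] n = ≤-trans (*-cancelˡ-< 2 n (k * suc q) (begin-strict
    2 * n            ≤⟨ m≤m+n (2 * n) d ⟩
    2 * n + d        <⟨ q-upper n ⟩
    D * suc q        ≤⟨ *-monoˡ-≤ (suc q) D≤2k ⟩
    2 * k * suc q    ≡⟨ *-assoc 2 k (suc q) ⟩
    2 * (k * suc q)  ∎))
    (*-monoʳ-≤ k (s≤s (q≤demand k ℓ n 0)))
    where
    open ≤-Reasoning
    q = qVal k ℓ n

module QuotaShift {k ℓ : ℕ} (1≤ℓ : 1 ≤ ℓ) (ℓ<k : ℓ < k) where

  open Quota 1≤ℓ ℓ<k
  module Q⁺ = Quota {suc k} {suc ℓ} (s≤s z≤n) (s≤s ℓ<k)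

  D⁺≡2+D : Q⁺.D ≡ 2 + D
  D⁺≡2+D = trans (+-suc k ℓ) (cong suc (sym (suc[m∸1]≡m (+-mono-≤ (≤-trans 1≤ℓ (<⇒≤ ℓ<k)) z≤n))))
    where
    suc[m∸1]≡m : ∀ {m} → 1 ≤ m → suc (m ∸ 1) ≡ m
    suc[m∸1]≡m (s≤s _) = refl

  module _ {n n′ : ℕ} (n≡ : n ≡ n′ + demand (suc k) (suc ℓ) n 0) where
    private
      Q T : ℕ
      Q = qVal (suc k) (suc ℓ) n
      T = demand (suc k) (suc ℓ) n 0

      surplus⁺ : ∀ j → Surplus (suc k) (suc ℓ) n j → (2 + D) * Q + 2 * j < 2 * (n′ + T)
      surplus⁺ j = subst₂ (λ E m → E * Q + 2 * j < 2 * m) D⁺≡2+D n≡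

      shifted : ∀ j → Surplus (suc k) (suc ℓ) n j → D * Q + 2 * j ≤ suc (2 * n′)
      shifted j s = [2+D]q+j<2[n+T]⇒Dq+j≤1+2n D Q n′ T (2 * j) (surplus⁺ j s) (demand≤1+q (suc k) (suc ℓ) n 0)

    q-shift : Q ≤ qVal k ℓ n′
    q-shift with surplus? (suc k) (suc ℓ) n 0
    ... | yes s = q-greatest n′ Q (begin
      D * Q          ≡⟨ +-identityʳ (D * Q) ⟨
      D * Q + 2 * 0  ≤⟨ shifted 0 s ⟩
      suc (2 * n′)   ≡⟨ +-comm 1 (2 * n′) ⟩
      2 * n′ + 1     ≤⟨ +-monoʳ-≤ (2 * n′) 0<d ⟩
      2 * n′ + d     ∎)
      where open ≤-Reasoning
    ... | no ¬s = q-greatest n′ Q ([2+D]q≤2[n+q]+d⇒Dq≤2n+d D Q n′ d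
      (subst₂ (λ E m → E * Q ≤ 2 * (n′ + m) + d) D⁺≡2+D (demand-no-surplus (suc k) (suc ℓ) n 0 ¬s)
              (subst (λ m → Q⁺.D * Q ≤ 2 * m + d) n≡ (Q⁺.q-lower n))))

    surplus-shift : ∀ i → Surplus (suc k) (suc ℓ) n (suc i) → D * Q + 2 * i < 2 * n′
    surplus-shift i s = +-cancelʳ-≤ 1 (suc (D * Q + 2 * i)) (2 * n′) (begin
      suc (D * Q + 2 * i) + 1  ≡⟨ shuffle D Q i ⟩
      D * Q + 2 * suc i        ≤⟨ shifted (suc i) s ⟩
      suc (2 * n′)             ≡⟨ +-comm 1 (2 * n′) ⟩
      2 * n′ + 1               ∎)
      where
      open ≤-Reasoning
      shuffle : ∀ D Q i → suc (D * Q + 2 * i) + 1 ≡ D * Q + 2 * suc i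
      shuffle = solve-∀

    demand-shift : ∀ i → demand (suc k) (suc ℓ) n (suc i) ≤ demand k ℓ n′ i
    demand-shift i with surplus? (suc k) (suc ℓ) n (suc i) | Q <? qVal k ℓ n′
    ... | no ¬s | _ = begin
      demand (suc k) (suc ℓ) n (suc i)  ≡⟨ demand-no-surplus (suc k) (suc ℓ) n (suc i) ¬s ⟩
      Q                                 ≤⟨ q-shift ⟩
      qVal k ℓ n′                       ≤⟨ q≤demand k ℓ n′ i ⟩
      demand k ℓ n′ i                   ∎
      where open ≤-Reasoning
    ... | yes s | yes Q<q′ = begin
      demand (suc k) (suc ℓ) n (suc i)  ≡⟨ demand-surplus (suc k) (suc ℓ) n (suc i) s ⟩
      suc Q                             ≤⟨ Q<q′ ⟩
      qVal k ℓ n′                       ≤⟨ q≤demand k ℓ n′ i ⟩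
      demand k ℓ n′ i                   ∎
      where open ≤-Reasoning
    ... | yes s | no Q≮q′ = begin
      demand (suc k) (suc ℓ) n (suc i)  ≡⟨ demand-surplus (suc k) (suc ℓ) n (suc i) s ⟩
      suc Q                             ≡⟨ cong suc Q≡q′ ⟩
      suc (qVal k ℓ n′)                 ≡⟨ demand-surplus k ℓ n′ i surplus′ ⟨
      demand k ℓ n′ i                   ∎
      where
      open ≤-Reasoning
      Q≡q′ : Q ≡ qVal k ℓ n′
      Q≡q′ = ≤-antisym q-shift (≮⇒≥ Q≮q′)
      surplus′ : Surplus k ℓ n′ i
      surplus′ = subst (λ q → D * q + 2 * i < 2 * n′) Q≡q′ (surplus-shift i s)

-- Partitions into blocks

∣insertAt-outside∣ : ∀ {n} (p : Subset n) i → ∣ insertAt p i outside ∣ ≡ ∣ p ∣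
∣insertAt-outside∣ p                 zero    = refl
∣insertAt-outside∣ (true  Vec.∷ p) (suc i) = cong suc (∣insertAt-outside∣ p i)
∣insertAt-outside∣ (false Vec.∷ p) (suc i) = ∣insertAt-outside∣ p i

punchIn-∈-insertAt : ∀ {n} {p : Subset n} {i} c v → i ∈ p → punchIn c i ∈ insertAt p c v
punchIn-∈-insertAt {p = p} {i} c v i∈p =
  lookup⇒[]= (punchIn c i) (insertAt p c v) (trans (insertAt-punchIn p c v i) ([]=⇒lookup i∈p))

∈-Block⇒ : ∀ {n m} {part : Fin n → Fin m} {j} x → x ∈ Block part j → part x ≡ j
∈-Block⇒ {part = part} {j} x x∈ = does⇒ (part x ≟ j) (begin
  does (part x ≟ j)                          ≡⟨ isYes≗does (part x ≟ j) ⟨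
  ⌊ part x ≟ j ⌋                             ≡⟨ lookup∘tabulate (λ y → ⌊ part y ≟ j ⌋) x ⟨
  Vec.lookup (Block part j) x                ≡⟨ []=⇒lookup x∈ ⟩
  true                                       ∎)
  where open ≡-Reasoning

BlockColours : ∀ {N k m} → Colouring N k → (Fin N → Fin m) → Fin m → (Fin k → Set) → Set
BlockColours g part j P = ∀ x {i} → g x ≡ just i → part x ≡ j → P i

-- Keeping uncoloured elements in block 0 makes every other block consist of coloured elements.
record Partition {N k} (ℓ : ℕ) (g : Colouring N k) : Set where
  field
    part         : Fin N → Fin (suc ℓ)
    uncoloured⇒0 : ∀ x → g x ≡ nothing → part x ≡ zero
    twoColoured  : ∀ j → ∃₂ λ a b → BlockColours g part (suc j) (λ i → i ≡ a ⊎ i ≡ b)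
    leftover     : ∃ λ I → ∣ I ∣ ≡ k ∸ ℓ ∸ 1 × BlockColours g part zero (_∈ I)

MeetsDemands : ∀ {N k} ℓ (g : Colouring N k) → Partition ℓ g → Set
MeetsDemands {k = k} ℓ g P =
  ∀ j → demand k ℓ (coloured g) (toℕ j) ≤ ∣ Block (Partition.part P) (suc j) ∣

partition-avoiding : ∀ {N k} (g : Colouring N (suc k)) c → (∀ x → g x ≢ just c) → Partition 0 g
partition-avoiding {k = k} g c avoid = record
  { part         = λ _ → zero
  ; uncoloured⇒0 = λ _ _ → refl
  ; twoColoured  = λ ()
  ; leftover     = I , trans (∣insertAt-outside∣ ⊤ c) (∣⊤∣≡n k) , I-contains
  }
  where
  I : Subset (suc k)
  I = insertAt ⊤ c outside
  I-contains : BlockColours g (λ _ → zero) zero (_∈ I)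
  I-contains x {i} gx≡i _ = subst (_∈ I) (punchIn-punchOut c≢i) (punchIn-∈-insertAt c outside ∈⊤)
    where
    c≢i : c ≢ i
    c≢i refl = avoid x gx≡i

removeColour : ∀ {k} → Fin (suc k) → Fin (suc k) → Maybe (Fin k)
removeColour c i with c ≟ i
... | yes _   = nothing
... | no c≢i = just (punchOut c≢i)

removeColour-≢ : ∀ {k} {c i : Fin (suc k)} → c ≢ i → ∃ λ i′ → removeColour c i ≡ just i′ × punchIn c i′ ≡ i
removeColour-≢ {c = c} {i} c≢i with c ≟ i
... | yes c≡i  = ⊥-elim (c≢i c≡i)
... | no  c≢i′ = punchOut c≢i′ , refl , punchIn-punchOut c≢i′

removeColour-just : ∀ {k} {c i : Fin (suc k)} {i′} → removeColour c i ≡ just i′ → punchIn c i′ ≡ i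
removeColour-just {c = c} {i} with c ≟ i
... | yes _   = λ ()
... | no c≢i = λ { refl → punchIn-punchOut c≢i }

place : ∀ {ℓ} → Bool → Fin (suc ℓ) → Fin (suc (suc ℓ))
place true  _ = suc zero
place false y = punchIn (suc zero) y

place≡1⇒ : ∀ {ℓ} β (y : Fin (suc ℓ)) → place β y ≡ suc zero → β ≡ true
place≡1⇒ true  y _ = refl
place≡1⇒ false y e = ⊥-elim (punchInᵢ≢i (suc zero) y e)

place≡punchIn⇒ : ∀ {ℓ} β (y j : Fin (suc ℓ)) → place β y ≡ punchIn (suc zero) j → β ≡ false × y ≡ j
place≡punchIn⇒ true  y j e = ⊥-elim (punchInᵢ≢i (suc zero) j (sym e))
place≡punchIn⇒ false y j e = refl , punchIn-injective (suc zero) y j e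

⌊place≟1⌋ : ∀ {ℓ} β (y : Fin (suc ℓ)) → ⌊ place β y ≟ suc zero ⌋ ≡ β
⌊place≟1⌋ true  y = refl
⌊place≟1⌋ false y = trans (isYes≗does (punchIn (suc zero) y ≟ suc zero))
                          (dec-false (punchIn (suc zero) y ≟ suc zero) (punchInᵢ≢i (suc zero) y))

⌊place≟punchIn⌋ : ∀ {ℓ} β (y : Fin (suc ℓ)) j → (β ≡ true → y ≡ zero) →
                  ⌊ place β y ≟ suc (suc j) ⌋ ≡ ⌊ y ≟ suc j ⌋
⌊place≟punchIn⌋ true  y j y≡0 rewrite y≡0 refl = refl
⌊place≟punchIn⌋ false y j _ = begin
  ⌊ punchIn (suc zero) y ≟ suc (suc j) ⌋     ≡⟨ isYes≗does (punchIn (suc zero) y ≟ suc (suc j)) ⟩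
  does (punchIn (suc zero) y ≟ suc (suc j))  ≡⟨ does-⇔ (mk⇔ (punchIn-injective (suc zero) y (suc j))
                                                           (cong (punchIn (suc zero))))
                                                      (punchIn (suc zero) y ≟ suc (suc j)) (y ≟ suc j) ⟩
  does (y ≟ suc j)                           ≡⟨ isYes≗does (y ≟ suc j) ⟨
  ⌊ y ≟ suc j ⌋                              ∎
  where open ≡-Reasoning

-- B becomes block 1. Deleting B and colour b leaves a colouring with one colour less, and a
-- partition of it extends to one of g by shifting its blocks up by one.
module Peel {N k} (g : Colouring N (suc k)) (a b : Fin (suc k)) (B : Fin N → Bool)
            (B⇒ab : ∀ x → B x ≡ true → ∃ λ i → g x ≡ just i × (i ≡ a ⊎ i ≡ b))
            (b⇒B : ∀ x → g x ≡ just b → B x ≡ true) where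

  remove : Bool → Maybe (Fin (suc k)) → Maybe (Fin k)
  remove true  _ = nothing
  remove false m = m >>= removeColour b

  remainder : Colouring N k
  remainder x = remove (B x) (g x)

  B⇒remainder≡nothing : ∀ x → B x ≡ true → remainder x ≡ nothing
  B⇒remainder≡nothing x B≡true = cong (λ β → remove β (g x)) B≡true

  uncoloured⇒¬B : ∀ x → g x ≡ nothing → B x ≡ false
  uncoloured⇒¬B x gx≡nothing with B x in B≡
  ... | false = refl
  ... | true with B⇒ab x B≡
  ...   | _ , gx≡just , _ = case trans (sym gx≡nothing) gx≡just of λ ()

  ¬B⇒b≢ : ∀ x {i} → B x ≡ false → g x ≡ just i → b ≢ i
  ¬B⇒b≢ x B≡false gx≡i refl = case trans (sym (b⇒B x gx≡i)) B≡false of λ ()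

  remainder-just : ∀ x {i′} → remainder x ≡ just i′ → B x ≡ false × g x ≡ just (punchIn b i′)
  remainder-just x with B x | g x
  ... | true  | _       = λ ()
  ... | false | nothing = λ ()
  ... | false | just i  = λ rem≡ → refl , cong just (sym (removeColour-just rem≡))

  coloured-split : coloured g ≡ count B + coloured remainder
  coloured-split = count-+ λ x → split (B x) (g x) (B⇒coloured x) (b⇒B x)
    where
    B⇒coloured : ∀ x → B x ≡ true → is-just (g x) ≡ true
    B⇒coloured x B≡true with B⇒ab x B≡true
    ... | _ , gx≡just , _ = cong is-just gx≡just
    split : ∀ β m → (β ≡ true → is-just m ≡ true) → (m ≡ just b → β ≡ true) →
            indicator (is-just m) ≡ indicator β + indicator (is-just (remove β m))
    split true  (just _) _   _ = refl
    split true  nothing  β⇒m _ = case β⇒m refl of λ ()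
    split false nothing  _   _ = refl
    split false (just i) _ b⇒β with removeColour-≢ {c = b} {i} (λ { refl → case b⇒β refl of λ () })
    ... | _ , removed , _ = cong (indicator ∘ is-just) (sym removed)

  module _ {ℓ} (P : Partition ℓ remainder) where
    open Partition P renaming (part to part′; uncoloured⇒0 to uncoloured⇒0′;
                               twoColoured to twoColoured′; leftover to leftover′)

    part : Fin N → Fin (suc (suc ℓ))
    part x = place (B x) (part′ x)

    colours-pullback : ∀ {Q : Fin k → Set} j → BlockColours remainder part′ j Q →
                       BlockColours g part (punchIn (suc zero) j) (λ i → ∃ λ i′ → Q i′ × punchIn b i′ ≡ i)
    colours-pullback j colours x gx≡i part≡ with place≡punchIn⇒ (B x) (part′ x) j part≡
    ... | B≡false , part′≡j with removeColour-≢ (¬B⇒b≢ x B≡false gx≡i)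
    ... | i′ , removed , punchIn≡ =
      i′ , colours x (trans (cong₂ remove B≡false gx≡i) removed) part′≡j , punchIn≡

    extend : Partition (suc ℓ) g
    extend = record
      { part         = part
      ; uncoloured⇒0 = λ x gx≡nothing → cong₂ place (uncoloured⇒¬B x gx≡nothing)
                         (uncoloured⇒0′ x (cong₂ remove (uncoloured⇒¬B x gx≡nothing) gx≡nothing))
      ; twoColoured  = twoColoured
      ; leftover     = leftover
      }
      where
      twoColoured : ∀ j → ∃₂ λ a b → BlockColours g part (suc j) (λ i → i ≡ a ⊎ i ≡ b)
      twoColoured zero = a , b , λ x gx≡i part≡ → case B⇒ab x (place≡1⇒ (B x) (part′ x) part≡) of λ
        { (i₀ , gx≡i₀ , i₀∈ab) → subst (λ i → i ≡ a ⊎ i ≡ b) (just-injective (trans (sym gx≡i₀) gx≡i)) i₀∈ab }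
      twoColoured (suc j) with twoColoured′ j
      ... | a′ , b′ , colours = punchIn b a′ , punchIn b b′ , λ x gx≡i part≡ →
        case colours-pullback (suc j) colours x gx≡i part≡ of λ
          { (i′ , i′∈ab , refl) → Sum.map (cong (punchIn b)) (cong (punchIn b)) i′∈ab }
      leftover : ∃ λ I → ∣ I ∣ ≡ suc k ∸ suc ℓ ∸ 1 × BlockColours g part zero (_∈ I)
      leftover with leftover′
      ... | I′ , ∣I′∣ , colours = insertAt I′ b outside , trans (∣insertAt-outside∣ I′ b) ∣I′∣ ,
            λ x gx≡i part≡ → case colours-pullback zero colours x gx≡i part≡ of λ
              { (i′ , i′∈I′ , refl) → punchIn-∈-insertAt b outside i′∈I′ }

    ∣first-block∣ : ∣ Block part (suc zero) ∣ ≡ count B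
    ∣first-block∣ = trans (∣tabulate∣≡count (λ x → ⌊ part x ≟ suc zero ⌋))
                          (count-cong λ x → ⌊place≟1⌋ (B x) (part′ x))

    ∣later-block∣ : ∀ j → ∣ Block part (suc (suc j)) ∣ ≡ ∣ Block part′ (suc j) ∣
    ∣later-block∣ j = cong ∣_∣ (tabulate-cong λ x →
      ⌊place≟punchIn⌋ (B x) (part′ x) j (uncoloured⇒0′ x ∘ B⇒remainder≡nothing x))

-- Induction on ℓ

straddling-colours : ∀ {N K ℓ} → 1 ≤ ℓ → ℓ < 2 + K → (g : Colouring N (2 + K)) →
                     ∃₂ λ a b → a ≢ b × classSize g b ≤ demand (2 + K) ℓ (coloured g) 0
                                      × demand (2 + K) ℓ (coloured g) 0 ≤ classSize g a + classSize g b
straddling-colours {K = K} {ℓ} 1≤ℓ ℓ<k g = straddling-pair (classSize g) T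
  (subst (λ n → (2 + K) * T < 2 * n + (2 + K)) (sym (∑-classSize g)) (k*demand₀<2n+k (coloured g)))
  (subst (_< (2 + K) * suc T) (sym (∑-classSize g)) (n<k*[1+demand₀] (coloured g)))
  where
  open Quota 1≤ℓ ℓ<k
  T : ℕ
  T = demand (2 + K) ℓ (coloured g) 0

top-up : ∀ {N k} (g : Colouring N k) {a b T} → a ≢ b →
         classSize g b ≤ T → T ≤ classSize g a + classSize g b →
         ∃ λ B → (∀ x → B x ≡ true → ∃ λ i → g x ≡ just i × (i ≡ a ⊎ i ≡ b))
               × (∀ x → g x ≡ just b → B x ≡ true) × count B ≡ T
top-up {N} g {a} {b} {T} a≢b cb≤T T≤ca+cb = B , B⇒ab , b⇒B , count-B
  where
  T∸cb≤ca : T ∸ classSize g b ≤ classSize g a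
  T∸cb≤ca = m≤n+o⇒m∸n≤o T (classSize g b) (subst (T ≤_) (+-comm (classSize g a) (classSize g b)) T≤ca+cb)

  part-of-a : ∃ λ S → (∀ x → S x ≡ true → g x hasColour a ≡ true) × count S ≡ T ∸ classSize g b
  part-of-a = ∃-subpredicate-of-count (λ x → g x hasColour a) (T ∸ classSize g b) T∸cb≤ca

  S : Fin N → Bool
  S = proj₁ part-of-a

  S⇒a : ∀ x → S x ≡ true → g x hasColour a ≡ true
  S⇒a = proj₁ (proj₂ part-of-a)

  B : Fin N → Bool
  B x = S x ∨ g x hasColour b

  B⇒ab : ∀ x → B x ≡ true → ∃ λ i → g x ≡ just i × (i ≡ a ⊎ i ≡ b)
  B⇒ab x B≡true with ∨-true (S x) _ B≡true
  ... | inj₁ in-S  = a , hasColour⇒≡ (g x) a (S⇒a x in-S) , inj₁ refl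
  ... | inj₂ has-b = b , hasColour⇒≡ (g x) b has-b , inj₂ refl

  b⇒B : ∀ x → g x ≡ just b → B x ≡ true
  b⇒B x gx≡b = trans (cong (S x ∨_) (≡⇒hasColour gx≡b)) (∨-zeroʳ _)

  count-B : count B ≡ T
  count-B = begin
    count B                              ≡⟨ count-+ (λ x → indicator-∨ _ _ (hasColour-disjoint (g x) a≢b ∘ S⇒a x)) ⟩
    count S + classSize g b              ≡⟨ cong (_+ classSize g b) (proj₂ (proj₂ part-of-a)) ⟩
    (T ∸ classSize g b) + classSize g b  ≡⟨ m∸n+n≡m cb≤T ⟩
    T                                    ∎
    where open ≡-Reasoning

-- Block 1 takes both classes whole, so colour a is unused in the remainder.
blockPartition-one : ∀ {N K} (g : Colouring N (2 + K)) → Σ (Partition 1 g) (MeetsDemands 1 g)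
blockPartition-one {N} {K} g with straddling-colours (s≤s z≤n) (s≤s (s≤s z≤n)) g
... | a , b , a≢b , _ , T≤ca+cb = extend P₀ , λ { zero → first-block }
  where
  B : Fin N → Bool
  B x = g x hasColour a ∨ g x hasColour b

  B⇒ab : ∀ x → B x ≡ true → ∃ λ i → g x ≡ just i × (i ≡ a ⊎ i ≡ b)
  B⇒ab x B≡true with ∨-true (g x hasColour a) _ B≡true
  ... | inj₁ has-a = a , hasColour⇒≡ (g x) a has-a , inj₁ refl
  ... | inj₂ has-b = b , hasColour⇒≡ (g x) b has-b , inj₂ refl

  b⇒B : ∀ x → g x ≡ just b → B x ≡ true
  b⇒B x gx≡b = trans (cong (g x hasColour a ∨_) (≡⇒hasColour gx≡b)) (∨-zeroʳ _)

  open Peel g a b B B⇒ab b⇒B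

  b≢a : b ≢ a
  b≢a = a≢b ∘ sym

  a-unused : ∀ x → remainder x ≢ just (punchOut b≢a)
  a-unused x rem≡ with remainder-just x rem≡
  ... | B≡false , gx≡ = case trans (sym B≡false) (cong (_∨ _) (≡⇒hasColour gx≡a)) of λ ()
    where
    gx≡a : g x ≡ just a
    gx≡a = trans gx≡ (cong just (punchIn-punchOut b≢a))

  P₀ : Partition 0 remainder
  P₀ = partition-avoiding remainder (punchOut b≢a) a-unused

  count-B : count B ≡ classSize g a + classSize g b
  count-B = count-+ λ x → indicator-∨ _ _ (hasColour-disjoint (g x) a≢b)

  first-block : demand (2 + K) 1 (coloured g) 0 ≤ ∣ Block (Partition.part (extend P₀)) (suc zero) ∣
  first-block = ≤-trans T≤ca+cb (≤-reflexive (sym (trans (∣first-block∣ P₀) count-B)))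

blockPartition-suc : ∀ {N K ℓ} → 1 ≤ ℓ → ℓ < 2 + K → (g : Colouring N (3 + K)) →
                     ((g′ : Colouring N (2 + K)) → Σ (Partition ℓ g′) (MeetsDemands ℓ g′)) →
                     Σ (Partition (suc ℓ) g) (MeetsDemands (suc ℓ) g)
blockPartition-suc {N} {K} {ℓ} 1≤ℓ ℓ<k g recurse with straddling-colours (s≤s z≤n) (s≤s ℓ<k) g
... | a , b , a≢b , cb≤T , T≤ca+cb with top-up g a≢b cb≤T T≤ca+cb
... | B , B⇒ab , b⇒B , count-B = extend P , demands
  where
  open Peel g a b B B⇒ab b⇒B

  n≡n′+T : coloured g ≡ coloured remainder + demand (3 + K) (suc ℓ) (coloured g) 0
  n≡n′+T = trans coloured-split (trans (cong (_+ coloured remainder) count-B) (+-comm (demand (3 + K) (suc ℓ) (coloured g) 0) (coloured remainder)))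

  P : Partition ℓ remainder
  P = proj₁ (recurse remainder)

  demands : MeetsDemands (suc ℓ) g (extend P)
  demands zero    = ≤-reflexive (sym (trans (∣first-block∣ P) count-B))
  demands (suc j) = begin
    demand (3 + K) (suc ℓ) (coloured g) (suc (toℕ j))    ≤⟨ QuotaShift.demand-shift 1≤ℓ ℓ<k n≡n′+T (toℕ j) ⟩
    demand (2 + K) ℓ (coloured remainder) (toℕ j)        ≤⟨ proj₂ (recurse remainder) j ⟩
    ∣ Block (Partition.part P) (suc j) ∣                 ≡⟨ ∣later-block∣ P j ⟨
    ∣ Block (Partition.part (extend P)) (suc (suc j)) ∣  ∎
    where open ≤-Reasoning

blockPartition : ∀ {N} k ℓ → 1 ≤ ℓ → ℓ < k → (g : Colouring N k) → Σ (Partition ℓ g) (MeetsDemands ℓ g)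
blockPartition (suc (suc K)) 1 _ _ g = blockPartition-one g
blockPartition (suc (suc (suc K))) (suc (suc ℓ)) _ (s≤s ℓ<k) g =
  blockPartition-suc (s≤s z≤n) ℓ<k g (blockPartition (suc (suc K)) (suc ℓ) (s≤s z≤n) ℓ<k)
blockPartition (suc (suc zero)) (suc (suc ℓ)) _ (s≤s (s≤s ())) g
blockPartition (suc zero)       (suc _)       _ (s≤s ())       g

mainTheorem5 : (k ℓ n : ℕ) → 1 ≤ ℓ → ℓ < k
    → (A : Fin k → Subset n)
    → (∀ (x : Fin n) → ∃[ i ] (x ∈ A i))
    → Σ (Fin n → Fin (suc ℓ)) λ part →
        (∀ (j : Fin ℓ) → ∃[ a ] ∃[ b ] (Block part (suc j) ⊆ (A a ∪ A b)))
        × (∀ (j : Fin ℓ) → suc (toℕ j) ≤ rVal k ℓ n → suc (qVal k ℓ n) ≤ ∣ Block part (suc j) ∣)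
        × (∀ (j : Fin ℓ) → rVal k ℓ n < suc (toℕ j) → qVal k ℓ n ≤ ∣ Block part (suc j) ∣)
        × (Σ (Subset k) λ I → (∣ I ∣ ≡ k ∸ ℓ ∸ 1)
             × (∀ (x : Fin n) → x ∈ Block part zero → ∃[ i ] (i ∈ I × x ∈ A i)))
mainTheorem5 k ℓ n 1≤ℓ ℓ<k A cover = part , pairs , large , atLeast-q , I , ∣I∣ , inI
  where
  colour : Fin n → Fin k
  colour = proj₁ ∘ cover
  in-colour : ∀ {x i} → colour x ≡ i → x ∈ A i
  in-colour refl = proj₂ (cover _)
  P : Σ (Partition ℓ (just ∘ colour)) (MeetsDemands ℓ (just ∘ colour))
  P = blockPartition k ℓ 1≤ℓ ℓ<k (just ∘ colour)
  open Partition (proj₁ P)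
  demands : ∀ j → demand k ℓ n (toℕ j) ≤ ∣ Block part (suc j) ∣
  demands = subst (λ m → ∀ j → demand k ℓ m (toℕ j) ≤ ∣ Block part (suc j) ∣) (count-true {n}) (proj₂ P)
  pairs : ∀ j → ∃[ a ] ∃[ b ] (Block part (suc j) ⊆ (A a ∪ A b))
  pairs j with twoColoured j
  ... | a , b , colours = a , b , λ {x} x∈ →
    x∈p∪q⁺ (Sum.map (in-colour {x}) (in-colour {x}) (colours x refl (∈-Block⇒ x x∈)))
  large : ∀ j → suc (toℕ j) ≤ rVal k ℓ n → suc (qVal k ℓ n) ≤ ∣ Block part (suc j) ∣
  large j j<r = ≤-trans (<rVal⇒1+q≤demand k ℓ n (toℕ j) j<r) (demands j)
  atLeast-q : ∀ j → rVal k ℓ n < suc (toℕ j) → qVal k ℓ n ≤ ∣ Block part (suc j) ∣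
  atLeast-q j _ = ≤-trans (q≤demand k ℓ n (toℕ j)) (demands j)
  I : Subset k
  I = proj₁ leftover
  ∣I∣ : ∣ I ∣ ≡ k ∸ ℓ ∸ 1
  ∣I∣ = proj₁ (proj₂ leftover)
  inI : ∀ x → x ∈ Block part zero → ∃[ i ] (i ∈ I × x ∈ A i)
  inI x x∈ = colour x , proj₂ (proj₂ leftover) x refl (∈-Block⇒ x x∈) , in-colour refl
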